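{- Let $\phi$ be a proper coloring of a cograph $G$. Then the following are equivalent: (i) $\phi$ is an acyclic coloring of $G$; (ii) for every cotree $T$ of $G$ and every $\oplus$-node $\tau$ of $T$, at most one child of $\tau$ is not saturated by $\phi$; (iii) $\phi$ is a proper coloring of some triangulation of $G$.
   Context: Cographs: a single vertex is a cograph; disjoint unions and joins (disjoint union plus all edges between distinct parts) of cographs are cographs. A cotree for a cograph $G$ is a rooted tree $T$ whose leaves correspond bijectively to the vertices of $G$ and whose internal nodes are labeled $\oplus$ or $\cup$, such that two distinct vertices are adjacent iff the lowest common ancestor of their leaves is a $\oplus$-node. For a node $\tau$ of $T$, $V_\tau$ is the set of vertices corresponding to leaves of the subtree rooted at $\tau$. A node $\tau$ is saturated by $\phi$ if $\phi(x)\neq\phi(y)$ for all distinct $x,y\in V_\tau$. A proper coloring gives adjacent vertices different colors; an acyclic coloring is a proper coloring in which every cycle uses at least three colors. A graph is chordal if every cycle of length greater than three has a chord; a triangulation of $G=(V,E)$ is a chordal graph $(V,E^+)$ with $E\subseteq E^+$. -}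

module Defs where

open import Data.Nat using (ℕ; zero; suc)
open import Data.Fin using (Fin; toℕ)
open import Data.Bool using (Bool; T)
open import Data.List using (List; concat; map; allFin)
open import Data.List.Membership.Propositional using (_∈_)
open import Data.List.Relation.Binary.Permutation.Propositional using (_↭_)
open import Data.Product using (Σ; ∃; ∃-syntax; _×_; _,_)
open import Data.Sum using (_⊎_)
open import Relation.Nullary using (¬_)
open import Relation.Binary.PropositionalEquality using (_≡_; _≢_)
open import Function.Definitions using (Injective)
open import Function.Bundles using (_⇔_)

record Graph (n : ℕ) : Set where
  field
    adj     : Fin n → Fin n → Bool
    adj-sym : ∀ x y → T (adj x y) → T (adj y x)
    irrefl  : ∀ x → ¬ T (adj x x)

open Graph public

Edge : ∀ {n} → Graph n → Fin n → Fin n → Set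
Edge G x y = T (adj G x y)

Coloring : ℕ → Set
Coloring n = Fin n → ℕ

Proper : ∀ {n} → Graph n → Coloring n → Set
Proper G φ = ∀ x y → Edge G x y → φ x ≢ φ y

Next : ∀ {k} → Fin k → Fin k → Set
Next {k} i j = (suc (toℕ i) ≡ toℕ j) ⊎ (suc (toℕ i) ≡ k × toℕ j ≡ 0)

IsCycle : ∀ {n} → Graph n → (k : ℕ) → (Fin k → Fin n) → Set
IsCycle G k c = (3 Data.Nat.≤ k) × Injective _≡_ _≡_ c × (∀ i j → Next i j → Edge G (c i) (c j))

UsesThreeColors : ∀ {n k} → Coloring n → (Fin k → Fin n) → Set
UsesThreeColors {k = k} φ c =
  ∃[ i ] ∃[ j ] ∃[ l ] (φ (c i) ≢ φ (c j) × φ (c j) ≢ φ (c l) × φ (c i) ≢ φ (c l))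

Acyclic : ∀ {n} → Graph n → Coloring n → Set
Acyclic G φ = Proper G φ × (∀ k c → IsCycle G k c → UsesThreeColors φ c)

HasChord : ∀ {n k} → Graph n → (Fin k → Fin n) → Set
HasChord G c = ∃[ i ] ∃[ j ] (i ≢ j × ¬ Next i j × ¬ Next j i × Edge G (c i) (c j))

Chordal : ∀ {n} → Graph n → Set
Chordal G = ∀ k c → 4 Data.Nat.≤ k → IsCycle G k c → HasChord G c

Triangulation : ∀ {n} → Graph n → Graph n → Set
Triangulation G H = Chordal H × (∀ x y → Edge G x y → Edge H x y)

data Label : Set where
  ⊕ ∪ : Label

data Cotree (n : ℕ) : Set where
  leaf : Fin n → Cotree n
  node : Label → (k : ℕ) → (Fin (suc k) → Cotree n) → Cotree n

leaves : ∀ {n} → Cotree n → List (Fin n)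
leaves (leaf v)     = v Data.List.∷ Data.List.[]
leaves (node _ k f) = concat (map (λ i → leaves (f i)) (allFin (suc k)))

-- σ is a node of τ (σ is the subtree rooted at some node of τ)
data _≼_ {n : ℕ} : Cotree n → Cotree n → Set where
  here  : ∀ {t} → t ≼ t
  there : ∀ {t l k f} (i : Fin (suc k)) → t ≼ f i → t ≼ node l k f

-- The lowest common ancestor of the leaves of x and y is a node with label l:
-- there is a node labelled l with two distinct children containing x and y.
LcaLabel : ∀ {n} → Cotree n → Fin n → Fin n → Label → Set
LcaLabel T x y l =
  ∃[ k ] Σ (Fin (suc k) → Cotree _) λ f →
    node l k f ≼ T × ∃[ i ] ∃[ j ] (i ≢ j × x ∈ leaves (f i) × y ∈ leaves (f j))

IsCotree : ∀ {n} → Graph n → Cotree n → Set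
IsCotree {n} G T =
  (leaves T ↭ allFin n) × (∀ x y → x ≢ y → Edge G x y ⇔ LcaLabel T x y ⊕)

Cograph : ∀ {n} → Graph n → Set
Cograph G = ∃[ T ] IsCotree G T

Saturated : ∀ {n} → Coloring n → Cotree n → Set
Saturated φ τ = ∀ x y → x ∈ leaves τ → y ∈ leaves τ → x ≢ y → φ x ≢ φ y

AtMostOneUnsaturated : ∀ {n} → Graph n → Coloring n → Set
AtMostOneUnsaturated G φ =
  ∀ T → IsCotree G T → ∀ k f → node ⊕ k f ≼ T →
    ∀ i j → ¬ Saturated φ (f i) → ¬ Saturated φ (f j) → i ≡ j

{-# OPTIONS --safe #-}
module Submission where

-- If two children of a ⊕-node both repeat a colour, φ a₁ = φ a₂ and φ b₁ = φ b₂,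
-- then a₁ b₁ a₂ b₂ is a two-coloured 4-cycle whose only possible chords join
-- equally coloured vertices; so (i) and (iii) fail when (ii) does.  Conversely,
-- every cycle has an edge between two children of some cotree node σ containing
-- the whole cycle.  σ is not a ∪-node, and if σ is a ⊕-node and the cycle has only
-- two colours, the two cycle-neighbours of a vertex in one child are equally
-- coloured vertices of another child, in both directions; so (ii) gives (i).
-- Finally, joining any two vertices of a common saturated node keeps φ proper,
-- and under (ii) every cycle of length at least four in this graph has a vertex
-- adjacent to all the others, hence a chord: if σ is a ⊕-node, any cycle vertex
-- in a saturated child of σ; if σ is a ∪-node, the crossing edge is a new edge,
-- so σ lies inside a saturated node and every cycle vertex qualifies.

open import Defs
open import Data.Nat using (ℕ; zero; suc; _≤_; s≤s; z≤n)
import Data.Nat.Properties as ℕ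
open import Data.Fin using (Fin; zero; suc; toℕ; fromℕ; fromℕ<; inject₁)
open import Data.Fin.Properties
  using (_≟_; all?; any?; ¬∀⟶∃¬; toℕ<n; toℕ-fromℕ; toℕ-fromℕ<; toℕ-inject₁)
open import Data.Bool using (Bool; true; false)
import Data.Bool.Properties as Bool
open import Data.List using (List; []; _∷_; _++_; concat; map; tabulate; allFin)
open import Data.List.Properties using (map-tabulate)
open import Data.List.Membership.Propositional using (_∈_)
open import Data.List.Membership.Propositional.Properties
  using (∈-concat⁻; ∈-concat⁺′; ∈-map⁺; ∈-allFin; ∈-tabulate⁺)
import Data.List.Membership.DecPropositional as DecMembership
open import Data.List.Relation.Unary.Any using (here; there)
open import Data.List.Relation.Unary.Any.Properties using (map⁻; tabulate⁻)
import Data.List.Relation.Unary.All as All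
open import Data.List.Relation.Unary.All.Properties using (++⁻ˡ; ++⁻ʳ)
open import Data.List.Relation.Unary.AllPairs using ([]; _∷_)
open import Data.List.Relation.Unary.Unique.Propositional using (Unique)
open import Data.List.Relation.Unary.Unique.Propositional.Properties using (allFin⁺)
open import Data.List.Relation.Binary.Permutation.Propositional using (↭-sym; ↭⇒↭ₛ)
open import Data.List.Relation.Binary.Permutation.Propositional.Properties using (∈-resp-↭)
import Data.List.Relation.Binary.Permutation.Setoid.Properties as Permutationₛ
open import Data.Vec using ([]; _∷_; lookup)
open import Data.Vec.Relation.Unary.All using ([]; _∷_)
open import Data.Vec.Relation.Unary.AllPairs using ([]; _∷_)
open import Data.Vec.Relation.Unary.Unique.Propositional using () renaming (Unique to Uniqueᵥ)
open import Data.Vec.Relation.Unary.Unique.Propositional.Properties using (lookup-injective)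
open import Data.Product using (∃-syntax; _×_; _,_; proj₁; proj₂; swap)
open import Data.Sum using (_⊎_; inj₁; inj₂)
open import Data.Unit using (⊤; tt)
open import Data.Empty using (⊥; ⊥-elim)
open import Function using (_∘_)
open import Function.Bundles using (_⇔_; mk⇔; Equivalence)
open import Function.Definitions using (Injective)
open import Relation.Nullary using (¬_; Dec; yes; no)
open import Relation.Nullary.Decidable
  using (_×-dec_; _⊎-dec_; _→-dec_; ¬?; map′; from-yes; decidable-stable; T?; ⌊_⌋; toWitness; fromWitness)
open import Relation.Unary using (Decidable)
open import Relation.Binary.PropositionalEquality
  using (_≡_; _≢_; refl; sym; trans; cong; subst; setoid)

Unique-++⁻ : ∀ {A : Set} (xs : List A) {ys : List A} → Unique (xs ++ ys) →
             Unique xs × Unique ys × (∀ {v} → v ∈ xs → v ∈ ys → ⊥)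
Unique-++⁻ []       u          = [] , u , λ ()
Unique-++⁻ (x ∷ xs) (x∉ ∷ u) with Unique-++⁻ xs u
... | uxs , uys , disjoint = ++⁻ˡ xs x∉ ∷ uxs , uys , disjoint′
  where
  disjoint′ : ∀ {v} → v ∈ x ∷ xs → v ∈ _ → ⊥
  disjoint′ (here refl) v∈ys = All.lookup (++⁻ʳ xs x∉) v∈ys refl
  disjoint′ (there v∈xs) v∈ys = disjoint v∈xs v∈ys

Unique-concat-tabulate⁻ : ∀ {A : Set} {m} (g : Fin m → List A) → Unique (concat (tabulate g)) →
                          (∀ a → Unique (g a)) × (∀ {a b x} → x ∈ g a → x ∈ g b → a ≡ b)
Unique-concat-tabulate⁻ {m = zero}  g u = (λ ()) , λ { {()} }
Unique-concat-tabulate⁻ {m = suc m} g u with Unique-++⁻ (g zero) u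
... | u₀ , uₛ , disjoint with Unique-concat-tabulate⁻ (g ∘ suc) uₛ
... | unique , same = unique′ , same′
  where
  unique′ : ∀ a → Unique (g a)
  unique′ zero    = u₀
  unique′ (suc a) = unique a
  same′ : ∀ {a b x} → x ∈ g a → x ∈ g b → a ≡ b
  same′ {zero}  {zero}  _ _ = refl
  same′ {zero}  {suc b} p q = ⊥-elim (disjoint p (∈-concat⁺′ q (∈-tabulate⁺ b)))
  same′ {suc a} {zero}  p q = ⊥-elim (disjoint q (∈-concat⁺′ p (∈-tabulate⁺ a)))
  same′ {suc a} {suc b} p q = cong suc (same p q)

Next? : ∀ {k} (i j : Fin k) → Dec (Next i j)
Next? {k} i j = (suc (toℕ i) ℕ.≟ toℕ j) ⊎-dec ((suc (toℕ i) ℕ.≟ k) ×-dec (toℕ j ℕ.≟ 0))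

Next-inject₁-suc : ∀ {k} (i : Fin k) → Next (inject₁ i) (suc i)
Next-inject₁-suc i = inj₁ (cong suc (toℕ-inject₁ i))

Next-successor : ∀ {k} (i : Fin (suc k)) → ∃[ j ] Next i j
Next-successor {k} i with suc (toℕ i) ℕ.<? suc k
... | yes i+1<k = fromℕ< i+1<k , inj₁ (sym (toℕ-fromℕ< i+1<k))
... | no  i+1≮k = zero , inj₂ (ℕ.≤-antisym (toℕ<n i) (ℕ.≮⇒≥ i+1≮k) , refl)

Next-predecessor : ∀ {k} (i : Fin (suc k)) → ∃[ j ] Next j i
Next-predecessor {k}     zero    = fromℕ k , inj₂ (cong suc (toℕ-fromℕ k) , refl)
Next-predecessor {suc k} (suc i) = inject₁ i , Next-inject₁-suc i

Next-asym : ∀ {k} {i j : Fin k} → 3 ≤ k → Next i j → Next j i → ⊥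
Next-asym _   (inj₁ i+1≡j)         (inj₁ j+1≡i)         =
  ℕ.<-asym (ℕ.≤-reflexive i+1≡j) (ℕ.≤-reflexive j+1≡i)
Next-asym 3≤k (inj₁ i+1≡j)         (inj₂ (j+1≡k , i≡0)) = length-two i+1≡j j+1≡k i≡0 3≤k
  where
  length-two : ∀ {i j k : ℕ} → suc i ≡ j → suc j ≡ k → i ≡ 0 → 3 ≤ k → ⊥
  length-two refl refl refl (s≤s (s≤s ()))
Next-asym 3≤k (inj₂ (i+1≡k , j≡0)) (inj₁ j+1≡i)         =
  Next-asym 3≤k (inj₁ j+1≡i) (inj₂ (i+1≡k , j≡0))
Next-asym 3≤k (inj₂ (i+1≡k , _))   (inj₂ (_ , i≡0))     = length-one i+1≡k i≡0 3≤k
  where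
  length-one : ∀ {i k : ℕ} → suc i ≡ k → i ≡ 0 → 3 ≤ k → ⊥
  length-one refl refl (s≤s ())

nonadjacent-index : ∀ {k} → 4 ≤ k → (i : Fin k) → ∃[ j ] (i ≢ j × ¬ Next i j × ¬ Next j i)
nonadjacent-index (s≤s (s≤s (s≤s (s≤s _)))) zero =
  suc (suc zero) , (λ ()) , (λ { (inj₁ ()) ; (inj₂ (() , _)) }) , (λ { (inj₁ ()) ; (inj₂ (() , _)) })
nonadjacent-index (s≤s (s≤s (s≤s (s≤s _)))) (suc zero) =
  suc (suc (suc zero)) , (λ ()) , (λ { (inj₁ ()) ; (inj₂ (() , _)) }) , (λ { (inj₁ ()) ; (inj₂ (_ , ())) })
nonadjacent-index (s≤s (s≤s (s≤s (s≤s _)))) (suc (suc zero)) =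
  zero , (λ ()) , (λ { (inj₁ ()) ; (inj₂ (() , _)) }) , (λ { (inj₁ ()) ; (inj₂ (() , _)) })
nonadjacent-index (s≤s (s≤s (s≤s (s≤s _)))) (suc (suc (suc i))) =
  suc zero , (λ ()) , (λ { (inj₁ ()) ; (inj₂ (_ , ())) }) , (λ { (inj₁ ()) ; (inj₂ (() , _)) })

change-point : ∀ {k} {P : Fin (suc k) → Set} → Decidable P → P zero → ∀ q → ¬ P q →
               ∃[ i ] (P (inject₁ i) × ¬ P (suc i))
change-point         P? p₀ zero    ¬p = ⊥-elim (¬p p₀)
change-point {zero}  P? p₀ (suc ()) ¬p
change-point {suc k} P? p₀ (suc q) ¬p with P? (suc zero)
... | no ¬p₁ = zero , p₀ , ¬p₁
... | yes p₁ = let i , pᵢ , ¬pᵢ₊₁ = change-point (P? ∘ suc) p₁ q ¬p in suc i , pᵢ , ¬pᵢ₊₁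

change-along-Next : ∀ {k} {P : Fin k → Set} → Decidable P → ∀ {p q} → P p → ¬ P q →
               ∃[ i ] ∃[ j ] (Next i j × (P i × ¬ P j ⊎ ¬ P i × P j))
change-along-Next {zero}  P? {()}
change-along-Next {suc k} P? {p} {q} Pp ¬Pq with P? zero
... | yes p₀ =
  let i , pᵢ , ¬pᵢ₊₁ = change-point P? p₀ q ¬Pq
  in inject₁ i , suc i , Next-inject₁-suc i , inj₁ (pᵢ , ¬pᵢ₊₁)
... | no ¬p₀ =
  let i , ¬pᵢ , ¬¬pᵢ₊₁ = change-point (¬? ∘ P?) ¬p₀ p (λ ¬Pp → ¬Pp Pp)
  in inject₁ i , suc i , Next-inject₁-suc i , inj₂ (¬pᵢ , decidable-stable (P? (suc i)) ¬¬pᵢ₊₁)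

isEven : Fin 4 → Bool
isEven zero                   = true
isEven (suc zero)             = false
isEven (suc (suc zero))       = true
isEven (suc (suc (suc zero))) = false

Next-flips-parity : ∀ (c d : Fin 4) → Next c d → isEven c ≢ isEven d
Next-flips-parity = from-yes (all? λ c → all? λ d → Next? c d →-dec ¬? (isEven c Bool.≟ isEven d))

nonadjacent-same-parity : ∀ (c d : Fin 4) → c ≢ d → ¬ Next c d → ¬ Next d c → isEven c ≡ isEven d
nonadjacent-same-parity = from-yes (all? λ c → all? λ d →
  ¬? (c ≟ d) →-dec ¬? (Next? c d) →-dec ¬? (Next? d c) →-dec (isEven c Bool.≟ isEven d))

Bool-pigeonhole : ∀ (u v w : Bool) → u ≡ v ⊎ v ≡ w ⊎ u ≡ w
Bool-pigeonhole false false _     = inj₁ refl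
Bool-pigeonhole true  true  _     = inj₁ refl
Bool-pigeonhole _     false false = inj₂ (inj₁ refl)
Bool-pigeonhole _     true  true  = inj₂ (inj₁ refl)
Bool-pigeonhole false true  false = inj₂ (inj₂ refl)
Bool-pigeonhole true  false true  = inj₂ (inj₂ refl)

IsCycle-mono : ∀ {n k} {G H : Graph n} {c : Fin k → Fin n} →
               (∀ x y → Edge G x y → Edge H x y) → IsCycle G k c → IsCycle H k c
IsCycle-mono G⊆H (3≤k , inj , edge) = 3≤k , inj , λ i j next → G⊆H _ _ (edge i j next)

universal-vertex-chord : ∀ {n k} {K : Graph n} {c : Fin k → Fin n} → 4 ≤ k → Injective _≡_ _≡_ c →
                         ∀ p → (∀ j → c p ≢ c j → Edge K (c p) (c j)) → HasChord K c
universal-vertex-chord 4≤k inj p universal =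
  let j , p≢j , ¬next , ¬next′ = nonadjacent-index 4≤k p
  in p , j , p≢j , ¬next , ¬next′ , universal j (p≢j ∘ inj)

UsesThreeColors? : ∀ {n k} (φ : Coloring n) (c : Fin k → Fin n) → Dec (UsesThreeColors φ c)
UsesThreeColors? φ c = any? λ i → any? λ j → any? λ l →
  ¬? (φ (c i) ℕ.≟ φ (c j)) ×-dec ¬? (φ (c j) ℕ.≟ φ (c l)) ×-dec ¬? (φ (c i) ℕ.≟ φ (c l))

two-colours : ∀ {n k} {φ : Coloring n} {c : Fin k → Fin n} → ¬ UsesThreeColors φ c →
              ∀ {p q r} → φ (c p) ≢ φ (c q) → φ (c p) ≢ φ (c r) → φ (c r) ≡ φ (c q)
two-colours {φ = φ} {c} ¬three {p} {q} {r} p≢q p≢r =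
  decidable-stable (φ (c r) ℕ.≟ φ (c q)) λ r≢q → ¬three (p , q , r , p≢q , r≢q ∘ sym , p≢r)

module _ {n : ℕ} where

  _∈?_ : (x : Fin n) (xs : List (Fin n)) → Dec (x ∈ xs)
  _∈?_ = DecMembership._∈?_ _≟_

  ∈-leaves⁻ : ∀ {l k} {f : Fin (suc k) → Cotree n} {x} →
              x ∈ leaves (node l k f) → ∃[ a ] x ∈ leaves (f a)
  ∈-leaves⁻ {k = k} {f} x∈ = tabulate⁻ (map⁻ (∈-concat⁻ (map (leaves ∘ f) (allFin (suc k))) x∈))

  ∈-leaves⁺ : ∀ {l k} {f : Fin (suc k) → Cotree n} {x} a →
              x ∈ leaves (f a) → x ∈ leaves (node l k f)
  ∈-leaves⁺ {f = f} a x∈ = ∈-concat⁺′ x∈ (∈-map⁺ (leaves ∘ f) (∈-allFin a))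

  ≼-trans : ∀ {s t u : Cotree n} → s ≼ t → t ≼ u → s ≼ u
  ≼-trans s≼t here          = s≼t
  ≼-trans s≼t (there a t≼u) = there a (≼-trans s≼t t≼u)

  ≼-leaves : ∀ {s t : Cotree n} {x} → s ≼ t → x ∈ leaves s → x ∈ leaves t
  ≼-leaves here                          x∈ = x∈
  ≼-leaves (there {l = l} {f = f} a s≼t) x∈ = ∈-leaves⁺ {l = l} {f = f} a (≼-leaves s≼t x∈)

  Separates : ∀ {k} → (Fin (suc k) → Cotree n) → Fin n → Fin n → Set
  Separates f x y = ∃[ a ] ∃[ b ] (a ≢ b × x ∈ leaves (f a) × y ∈ leaves (f b))

  DisjointChildren : Cotree n → Set
  DisjointChildren (leaf _)     = ⊤
  DisjointChildren (node _ _ f) =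
    (∀ {a b x} → x ∈ leaves (f a) → x ∈ leaves (f b) → a ≡ b) × (∀ a → DisjointChildren (f a))

  Unique⇒DisjointChildren : ∀ t → Unique (leaves t) → DisjointChildren t
  Unique⇒DisjointChildren (leaf _)     _ = tt
  Unique⇒DisjointChildren (node l k f) u =
    let unique , same = Unique-concat-tabulate⁻ (leaves ∘ f) (subst Unique leaves-node u)
    in same , λ a → Unique⇒DisjointChildren (f a) (unique a)
    where
    leaves-node : leaves (node l k f) ≡ concat (tabulate (leaves ∘ f))
    leaves-node = cong concat (map-tabulate (λ i → i) (leaves ∘ f))

  DisjointChildren-≼ : ∀ {s t} → s ≼ t → DisjointChildren t → DisjointChildren s
  DisjointChildren-≼ here          d = d
  DisjointChildren-≼ (there a s≼t) d = DisjointChildren-≼ s≼t (proj₂ d a)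

  separated-distinct : ∀ {l k} {f : Fin (suc k) → Cotree n} {x y} →
                       DisjointChildren (node l k f) → Separates f x y → x ≢ y
  separated-distinct d (a , b , a≢b , x∈ , y∈) refl = a≢b (proj₁ d x∈ y∈)

  separated-not-in-one-child : ∀ {l k} {f : Fin (suc k) → Cotree n} {x y} a →
    DisjointChildren (node l k f) → Separates f x y → x ∈ leaves (f a) → y ∈ leaves (f a) → ⊥
  separated-not-in-one-child _ d (b , c , b≢c , x∈b , y∈c) x∈a y∈a =
    b≢c (trans (proj₁ d x∈b x∈a) (proj₁ d y∈a y∈c))

  ≼-comparable : ∀ {s u t : Cotree n} {x} → DisjointChildren t → s ≼ t → u ≼ t →
                 x ∈ leaves s → x ∈ leaves u → s ≼ u ⊎ u ≼ s
  ≼-comparable d here          u≼t           _   _   = inj₂ u≼t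
  ≼-comparable d (there a s≼t) here          _   _   = inj₁ (there a s≼t)
  ≼-comparable d (there a s≼t) (there b u≼t) x∈s x∈u
    with proj₁ d (≼-leaves s≼t x∈s) (≼-leaves u≼t x∈u)
  ... | refl = ≼-comparable (proj₂ d a) s≼t u≼t x∈s x∈u

  separating-≼ : ∀ {t ν : Cotree n} {l k} {f : Fin (suc k) → Cotree n} {x y} → DisjointChildren t →
                 node l k f ≼ t → ν ≼ t → Separates f x y →
                 x ∈ leaves ν → y ∈ leaves ν → node l k f ≼ ν
  separating-≼ {l = l} {f = f} d σ≼t ν≼t sep@(a , _ , _ , x∈a , _) x∈ν y∈ν
    with ≼-comparable d σ≼t ν≼t (∈-leaves⁺ {l = l} {f = f} a x∈a) x∈ν
  ... | inj₁ σ≼ν            = σ≼ν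
  ... | inj₂ here           = here
  ... | inj₂ (there b ν≼fb) =
    ⊥-elim (separated-not-in-one-child {l = l} b (DisjointChildren-≼ σ≼t d) sep
             (≼-leaves ν≼fb x∈ν) (≼-leaves ν≼fb y∈ν))

  separating-label-unique : ∀ {t : Cotree n} {l l′ m m′} {f : Fin (suc m) → Cotree n}
                            {f′ : Fin (suc m′) → Cotree n} {x y} → DisjointChildren t →
                            node l m f ≼ t → Separates f x y →
                            node l′ m′ f′ ≼ t → Separates f′ x y → l ≡ l′
  separating-label-unique {l = l} {l′} {f = f} {f′} d σ≼t sep@(a , b , _ , x∈a , y∈b)
                          σ′≼t sep′@(a′ , b′ , _ , x∈a′ , y∈b′)
    with separating-≼ d σ≼t σ′≼t sep (∈-leaves⁺ {l = l′} {f = f′} a′ x∈a′)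
                                     (∈-leaves⁺ {l = l′} {f = f′} b′ y∈b′)
  ... | here          = refl
  ... | there c σ≼f′c =
    ⊥-elim (separated-not-in-one-child {l = l′} c (DisjointChildren-≼ σ′≼t d) sep′
             (≼-leaves σ≼f′c (∈-leaves⁺ {l = l} {f = f} a x∈a))
             (≼-leaves σ≼f′c (∈-leaves⁺ {l = l} {f = f} b y∈b)))

  data CrossingEdge {k} (t : Cotree n) (c : Fin k → Fin n) : Set where
    crossing : ∀ l {m} {f : Fin (suc m) → Cotree n} → node l m f ≼ t →
               (∀ j → c j ∈ leaves (node l m f)) →
               ∀ {i j} → Next i j → Separates f (c i) (c j) → CrossingEdge t c

  other-child : ∀ {l m} {f : Fin (suc m) → Cotree n} {x a} →
                x ∈ leaves (node l m f) → ¬ x ∈ leaves (f a) → ∃[ b ] (a ≢ b × x ∈ leaves (f b))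
  other-child {l = l} {f = f} x∈ x∉a with ∈-leaves⁻ {l = l} {f = f} x∈
  ... | b , x∈b = b , (λ { refl → x∉a x∈b }) , x∈b

  crossing-at-node : ∀ {k l m} {f : Fin (suc m) → Cotree n} (c : Fin k → Fin n) {a i j} →
                     (∀ r → c r ∈ leaves (node l m f)) → c i ∈ leaves (f a) → ¬ c j ∈ leaves (f a) →
                     CrossingEdge (node l m f) c
  crossing-at-node {l = l} {f = f} c {a} covers cᵢ∈a cⱼ∉a
    with change-along-Next (λ r → c r ∈? leaves (f a)) cᵢ∈a cⱼ∉a
  ... | i , j , next , inj₁ (cᵢ∈a , cⱼ∉a) =
    let b , a≢b , cⱼ∈b = other-child {l = l} {f = f} (covers j) cⱼ∉a
    in crossing l {f = f} here covers next (a , b , a≢b , cᵢ∈a , cⱼ∈b)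
  ... | i , j , next , inj₂ (cᵢ∉a , cⱼ∈a) =
    let b , a≢b , cᵢ∈b = other-child {l = l} {f = f} (covers i) cᵢ∉a
    in crossing l {f = f} here covers next (b , a , a≢b ∘ sym , cᵢ∈b , cⱼ∈a)

  crossing-edge : ∀ {k} (c : Fin k → Fin n) → Injective _≡_ _≡_ c → ∀ {i₀ i₁} → i₀ ≢ i₁ →
                  ∀ t → (∀ j → c j ∈ leaves t) → CrossingEdge t c
  crossing-edge c inj {i₀} {i₁} i₀≢i₁ (leaf v) covers with covers i₀ | covers i₁
  ... | here cᵢ₀≡v | here cᵢ₁≡v = ⊥-elim (i₀≢i₁ (inj (trans cᵢ₀≡v (sym cᵢ₁≡v))))
  crossing-edge {k} c inj {i₀} i₀≢i₁ (node l m f) covers with ∈-leaves⁻ {l = l} {f = f} (covers i₀)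
  ... | a , cᵢ₀∈a with all? (λ j → c j ∈? leaves (f a))
  ... | yes all∈a = lift (crossing-edge c inj i₀≢i₁ (f a) all∈a)
    where
    lift : CrossingEdge (f a) c → CrossingEdge (node l m f) c
    lift (crossing l′ σ≼ covers′ next sides) =
      crossing l′ (≼-trans σ≼ (there a here)) covers′ next sides
  ... | no ¬all∈a =
    crossing-at-node c covers cᵢ₀∈a (proj₂ (¬∀⟶∃¬ k _ (λ j → c j ∈? leaves (f a)) ¬all∈a))

module _ {n : ℕ} (φ : Coloring n) where

  record MonochromaticPair (t : Cotree n) : Set where
    field
      {fst snd}   : Fin n
      fst∈        : fst ∈ leaves t
      snd∈        : snd ∈ leaves t
      distinct    : fst ≢ snd
      same-colour : φ fst ≡ φ snd

  MonochromaticPair? : ∀ t → Dec (MonochromaticPair t)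
  MonochromaticPair? t =
    map′ (λ (_ , _ , x∈ , y∈ , x≢y , φx≡φy) →
            record { fst∈ = x∈ ; snd∈ = y∈ ; distinct = x≢y ; same-colour = φx≡φy })
         (λ P → let open MonochromaticPair P in fst , snd , fst∈ , snd∈ , distinct , same-colour)
         (any? λ x → any? λ y →
            x ∈? leaves t ×-dec y ∈? leaves t ×-dec ¬? (x ≟ y) ×-dec φ x ℕ.≟ φ y)

  MonochromaticPair⇒¬Saturated : ∀ {t} → MonochromaticPair t → ¬ Saturated φ t
  MonochromaticPair⇒¬Saturated P sat = sat fst snd fst∈ snd∈ distinct same-colour
    where open MonochromaticPair P

  ¬MonochromaticPair⇒Saturated : ∀ {t} → ¬ MonochromaticPair t → Saturated φ t
  ¬MonochromaticPair⇒Saturated ¬P x y x∈ y∈ x≢y φx≡φy =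
    ¬P record { fst∈ = x∈ ; snd∈ = y∈ ; distinct = x≢y ; same-colour = φx≡φy }

  Saturated? : ∀ t → Dec (Saturated φ t)
  Saturated? t = map′ ¬MonochromaticPair⇒Saturated (λ sat P → MonochromaticPair⇒¬Saturated P sat)
                      (¬? (MonochromaticPair? t))

  ¬Saturated⇒MonochromaticPair : ∀ {t} → ¬ Saturated φ t → MonochromaticPair t
  ¬Saturated⇒MonochromaticPair {t} ¬sat =
    decidable-stable (MonochromaticPair? t) (¬sat ∘ ¬MonochromaticPair⇒Saturated)

  SaturatedTogether : Cotree n → Fin n → Fin n → Set
  SaturatedTogether t x y = ∃[ ν ] (ν ≼ t × Saturated φ ν × x ∈ leaves ν × y ∈ leaves ν)

  SaturatedTogether? : ∀ t x y → Dec (SaturatedTogether t x y)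
  SaturatedTogether? t x y = map′ at-or-below classify (at t ⊎-dec below t)
    where
    At : Cotree n → Set
    At ν = Saturated φ ν × x ∈ leaves ν × y ∈ leaves ν
    at : ∀ ν → Dec (At ν)
    at ν = Saturated? ν ×-dec x ∈? leaves ν ×-dec y ∈? leaves ν
    Below : Cotree n → Set
    Below (leaf _)     = ⊥
    Below (node _ _ f) = ∃[ a ] SaturatedTogether (f a) x y
    below : ∀ t → Dec (Below t)
    below (leaf _)     = no λ ()
    below (node _ _ f) = any? λ a → SaturatedTogether? (f a) x y
    at-or-below : ∀ {t} → At t ⊎ Below t → SaturatedTogether t x y
    at-or-below {t}          (inj₁ h)                = t , here , h
    at-or-below {node _ _ _} (inj₂ (a , ν , ν≼ , h)) = ν , there a ν≼ , h
    classify : ∀ {t} → SaturatedTogether t x y → At t ⊎ Below t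
    classify (_ , here , h)       = inj₁ h
    classify (ν , there a ν≼ , h) = inj₂ (a , ν , ν≼ , h)

AtMostOneUnsaturatedIn : ∀ {n} → Cotree n → Coloring n → Set
AtMostOneUnsaturatedIn T φ =
  ∀ m f → node ⊕ m f ≼ T → ∀ i j → ¬ Saturated φ (f i) → ¬ Saturated φ (f j) → i ≡ j

module _ {n : ℕ} (G : Graph n) {T : Cotree n} (cot : IsCotree G T) where

  private
    ∈-root : ∀ x → x ∈ leaves T
    ∈-root x = ∈-resp-↭ (↭-sym (proj₁ cot)) (∈-allFin x)

    disjoint : DisjointChildren T
    disjoint = Unique⇒DisjointChildren T
      (Permutationₛ.Unique-resp-↭ (setoid (Fin n)) (↭⇒↭ₛ (↭-sym (proj₁ cot))) (allFin⁺ n))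

    separated-in-T-distinct : ∀ {l m} {f : Fin (suc m) → Cotree n} {x y} →
                              node l m f ≼ T → Separates f x y → x ≢ y
    separated-in-T-distinct {l} σ≼T = separated-distinct {l = l} (DisjointChildren-≼ σ≼T disjoint)

  ⊕-separated-adjacent : ∀ {m} {f : Fin (suc m) → Cotree n} {x y} →
                         node ⊕ m f ≼ T → Separates f x y → Edge G x y
  ⊕-separated-adjacent {m} {f} σ≼T sep =
    Equivalence.from (proj₂ cot _ _ (separated-in-T-distinct σ≼T sep)) (m , f , σ≼T , sep)

  ∪-separated-nonadjacent : ∀ {m} {f : Fin (suc m) → Cotree n} {x y} →
                            node ∪ m f ≼ T → Separates f x y → ¬ Edge G x y
  ∪-separated-nonadjacent σ≼T sep xy
    with Equivalence.to (proj₂ cot _ _ (separated-in-T-distinct σ≼T sep)) xy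
  ... | _ , _ , σ′≼T , sep′ with separating-label-unique disjoint σ≼T sep σ′≼T sep′
  ... | ()

  cycle-crossing : ∀ {K k c} → IsCycle K k c → CrossingEdge T c
  cycle-crossing {k = suc (suc _)} {c} (_ , inj , _) =
    crossing-edge c inj {zero} {suc zero} (λ ()) T (∈-root ∘ c)
  cycle-crossing {k = 0} (() , _)
  cycle-crossing {k = 1} (s≤s () , _)

  module Square {φ : Coloring n} {m} {f : Fin (suc m) → Cotree n} (σ≼T : node ⊕ m f ≼ T)
                {i j} (i≢j : i ≢ j) (A : MonochromaticPair φ (f i)) (B : MonochromaticPair φ (f j)) where

    open MonochromaticPair A renaming (fst to a₁; snd to a₂; fst∈ to a₁∈; snd∈ to a₂∈;
                                       distinct to a₁≢a₂; same-colour to φa₁≡φa₂)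
    open MonochromaticPair B renaming (fst to b₁; snd to b₂; fst∈ to b₁∈; snd∈ to b₂∈;
                                       distinct to b₁≢b₂; same-colour to φb₁≡φb₂)

    square : Fin 4 → Fin n
    square = lookup (a₁ ∷ b₁ ∷ a₂ ∷ b₂ ∷ [])

    child : Bool → Fin (suc m)
    child true  = i
    child false = j

    child-injective : ∀ {s t} → child s ≡ child t → s ≡ t
    child-injective {true}  {true}  _   = refl
    child-injective {true}  {false} i≡j = ⊥-elim (i≢j i≡j)
    child-injective {false} {true}  j≡i = ⊥-elim (i≢j (sym j≡i))
    child-injective {false} {false} _   = refl

    square-child : ∀ c → square c ∈ leaves (f (child (isEven c)))
    square-child zero                   = a₁∈
    square-child (suc zero)             = b₁∈
    square-child (suc (suc zero))       = a₂∈
    square-child (suc (suc (suc zero))) = b₂∈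

    colour : Bool → ℕ
    colour true  = φ a₁
    colour false = φ b₁

    square-colour : ∀ c → φ (square c) ≡ colour (isEven c)
    square-colour zero                   = refl
    square-colour (suc zero)             = refl
    square-colour (suc (suc zero))       = sym φa₁≡φa₂
    square-colour (suc (suc (suc zero))) = sym φb₁≡φb₂

    same-parity-same-colour : ∀ {c d} → isEven c ≡ isEven d → φ (square c) ≡ φ (square d)
    same-parity-same-colour {c} {d} c~d =
      trans (square-colour c) (trans (cong colour c~d) (sym (square-colour d)))

    square-cycle : IsCycle G 4 square
    square-cycle = s≤s (s≤s (s≤s z≤n)) , lookup-injective corners-distinct _ _ , edge
      where
      a≢b : ∀ {x y} → x ∈ leaves (f i) → y ∈ leaves (f j) → x ≢ y
      a≢b x∈ y∈ = separated-in-T-distinct σ≼T (i , j , i≢j , x∈ , y∈)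
      b≢a : ∀ {x y} → x ∈ leaves (f j) → y ∈ leaves (f i) → x ≢ y
      b≢a y∈ x∈ = a≢b x∈ y∈ ∘ sym
      corners-distinct : Uniqueᵥ (a₁ ∷ b₁ ∷ a₂ ∷ b₂ ∷ [])
      corners-distinct = (a≢b a₁∈ b₁∈ ∷ a₁≢a₂ ∷ a≢b a₁∈ b₂∈ ∷ [])
                       ∷ (b≢a b₁∈ a₂∈ ∷ b₁≢b₂ ∷ [])
                       ∷ (a≢b a₂∈ b₂∈ ∷ [])
                       ∷ [] ∷ []
      edge : ∀ c d → Next c d → Edge G (square c) (square d)
      edge c d next = ⊕-separated-adjacent σ≼T
        (child (isEven c) , child (isEven d) , Next-flips-parity c d next ∘ child-injective ,
         square-child c , square-child d)

    square-two-coloured : ¬ UsesThreeColors φ square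
    square-two-coloured (c , d , e , c≁d , d≁e , c≁e) with Bool-pigeonhole (isEven c) (isEven d) (isEven e)
    ... | inj₁ c~d        = c≁d (same-parity-same-colour c~d)
    ... | inj₂ (inj₁ d~e) = d≁e (same-parity-same-colour d~e)
    ... | inj₂ (inj₂ c~e) = c≁e (same-parity-same-colour c~e)

    square-chordless : ∀ {K} → Proper K φ → ¬ HasChord K square
    square-chordless proper (c , d , c≢d , ¬next , ¬next′ , chord) =
      proper _ _ chord (same-parity-same-colour (nonadjacent-same-parity c d c≢d ¬next ¬next′))

  Acyclic⇒AtMostOneUnsaturated : ∀ {φ} → Acyclic G φ → AtMostOneUnsaturatedIn T φ
  Acyclic⇒AtMostOneUnsaturated {φ} (_ , acyclic) m f σ≼T i j ¬satᵢ ¬satⱼ with i ≟ j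
  ... | yes i≡j = i≡j
  ... | no  i≢j = ⊥-elim (square-two-coloured (acyclic 4 square square-cycle))
    where
    open Square σ≼T i≢j (¬Saturated⇒MonochromaticPair φ ¬satᵢ) (¬Saturated⇒MonochromaticPair φ ¬satⱼ)

  ProperTriangulation⇒AtMostOneUnsaturated : ∀ {φ} → ∃[ H ] (Triangulation G H × Proper H φ) →
                                             AtMostOneUnsaturatedIn T φ
  ProperTriangulation⇒AtMostOneUnsaturated {φ} (H , (chordal , G⊆H) , proper) m f σ≼T i j ¬satᵢ ¬satⱼ
    with i ≟ j
  ... | yes i≡j = i≡j
  ... | no  i≢j =
    ⊥-elim (square-chordless {K = H} proper
             (chordal 4 square ℕ.≤-refl (IsCycle-mono {G = G} {H} G⊆H square-cycle)))
    where
    open Square σ≼T i≢j (¬Saturated⇒MonochromaticPair φ ¬satᵢ) (¬Saturated⇒MonochromaticPair φ ¬satⱼ)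

  module _ (φ : Coloring n) where

    SaturatedFillEdge : Fin n → Fin n → Set
    SaturatedFillEdge x y = Edge G x y ⊎ (x ≢ y × SaturatedTogether φ T x y)

    SaturatedFillEdge? : ∀ x y → Dec (SaturatedFillEdge x y)
    SaturatedFillEdge? x y = T? (adj G x y) ⊎-dec ¬? (x ≟ y) ×-dec SaturatedTogether? φ T x y

    saturatedFill : Graph n
    saturatedFill = record
      { adj     = λ x y → ⌊ SaturatedFillEdge? x y ⌋
      ; adj-sym = λ x y → fromWitness ∘ symmetric ∘ toWitness
      ; irrefl  = λ x → irreflexive ∘ toWitness
      }
      where
      symmetric : ∀ {x y} → SaturatedFillEdge x y → SaturatedFillEdge y x
      symmetric (inj₁ xy)                         = inj₁ (adj-sym G _ _ xy)
      symmetric (inj₂ (x≢y , ν , ν≼T , sat , xy∈)) = inj₂ (x≢y ∘ sym , ν , ν≼T , sat , swap xy∈)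
      irreflexive : ∀ {x} → ¬ SaturatedFillEdge x x
      irreflexive (inj₁ xx)        = irrefl G _ xx
      irreflexive (inj₂ (x≢x , _)) = x≢x refl

    saturatedFill-edge⁺ : ∀ {x y} → SaturatedFillEdge x y → Edge saturatedFill x y
    saturatedFill-edge⁺ {x} {y} = fromWitness {a? = SaturatedFillEdge? x y}

    saturatedFill-edge⁻ : ∀ {x y} → Edge saturatedFill x y → SaturatedFillEdge x y
    saturatedFill-edge⁻ {x} {y} = toWitness {a? = SaturatedFillEdge? x y}

    saturatedFill-supergraph : ∀ x y → Edge G x y → Edge saturatedFill x y
    saturatedFill-supergraph _ _ = saturatedFill-edge⁺ ∘ inj₁

    together-adjacent : ∀ {ν x y} → ν ≼ T → Saturated φ ν →
                        x ∈ leaves ν → y ∈ leaves ν → x ≢ y → Edge saturatedFill x y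
    together-adjacent ν≼T sat x∈ y∈ x≢y =
      saturatedFill-edge⁺ (inj₂ (x≢y , _ , ν≼T , sat , x∈ , y∈))

    saturated-child-adjacent : ∀ {m} {f : Fin (suc m) → Cotree n} {a x y} → node ⊕ m f ≼ T →
                               Saturated φ (f a) → x ∈ leaves (f a) → y ∈ leaves (node ⊕ m f) → x ≢ y →
                               Edge saturatedFill x y
    saturated-child-adjacent {f = f} {a} σ≼T sat x∈a y∈ x≢y with ∈-leaves⁻ {l = ⊕} {f = f} y∈
    ... | b , y∈b with a ≟ b
    ... | yes refl = together-adjacent (≼-trans (there a here) σ≼T) sat x∈a y∈b x≢y
    ... | no  a≢b  = saturatedFill-edge⁺ (inj₁ (⊕-separated-adjacent σ≼T (a , b , a≢b , x∈a , y∈b)))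

    saturatedFill-chordal : AtMostOneUnsaturatedIn T φ → Chordal saturatedFill
    saturatedFill-chordal amou k c 4≤k cycle@(_ , inj , edge) with cycle-crossing {K = saturatedFill} cycle
    ... | crossing ∪ σ≼T covers {i} {j} next sep with saturatedFill-edge⁻ (edge i j next)
    ...   | inj₁ cᵢ~cⱼ = ⊥-elim (∪-separated-nonadjacent σ≼T sep cᵢ~cⱼ)
    ...   | inj₂ (_ , ν , ν≼T , sat , cᵢ∈ν , cⱼ∈ν) =
      let σ≼ν = separating-≼ disjoint σ≼T ν≼T sep cᵢ∈ν cⱼ∈ν
      in universal-vertex-chord {K = saturatedFill} 4≤k inj i λ r →
           together-adjacent ν≼T sat cᵢ∈ν (≼-leaves σ≼ν (covers r))
    saturatedFill-chordal amou k c 4≤k cycle@(_ , inj , edge)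
      | crossing ⊕ {f = f} σ≼T covers {i} {j} next (a , b , a≢b , cᵢ∈a , cⱼ∈b) with Saturated? φ (f a)
    ... | yes satₐ = universal-vertex-chord {K = saturatedFill} 4≤k inj i λ r →
                       saturated-child-adjacent σ≼T satₐ cᵢ∈a (covers r)
    ... | no ¬satₐ = universal-vertex-chord {K = saturatedFill} 4≤k inj j λ r →
                       saturated-child-adjacent σ≼T sat_b cⱼ∈b (covers r)
      where
      sat_b : Saturated φ (f b)
      sat_b = decidable-stable (Saturated? φ (f b)) λ ¬sat_b → a≢b (amou _ _ σ≼T a b ¬satₐ ¬sat_b)

  module _ {φ : Coloring n} (proper : Proper G φ) where

    same-colour-same-child : ∀ {m} {f : Fin (suc m) → Cotree n} {x y b} → node ⊕ m f ≼ T →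
                             x ∈ leaves (node ⊕ m f) → y ∈ leaves (f b) → φ x ≡ φ y → x ∈ leaves (f b)
    same-colour-same-child {f = f} {b = b} σ≼T x∈ y∈b φx≡φy with ∈-leaves⁻ {l = ⊕} {f = f} x∈
    ... | a , x∈a with a ≟ b
    ... | yes refl = x∈a
    ... | no  a≢b  = ⊥-elim (proper _ _ (⊕-separated-adjacent σ≼T (a , b , a≢b , x∈a , y∈b)) φx≡φy)

    -- the two cycle-neighbours of c p are coloured like c q, hence lie in the child of c q
    two-coloured-cycle-unsaturates :
      ∀ {k c m} {f : Fin (suc m) → Cotree n} → IsCycle G k c → ¬ UsesThreeColors φ c →
      node ⊕ m f ≼ T → (∀ r → c r ∈ leaves (node ⊕ m f)) →
      ∀ {p q a b} → a ≢ b → c p ∈ leaves (f a) → c q ∈ leaves (f b) → ¬ Saturated φ (f b)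
    two-coloured-cycle-unsaturates {c = c} {f = f} (3≤k@(s≤s _) , inj , edge) ¬three σ≼T covers
                                   {p} {q} {a} {b} a≢b cp∈a cq∈b sat =
      let s , p→s = Next-successor p
          r , r→p = Next-predecessor p
          p~s = edge p s p→s
          p~r = adj-sym G _ _ (edge r p r→p)
          s≢r : s ≢ r
          s≢r s≡r = Next-asym 3≤k p→s (subst (λ t → Next t p) (sym s≡r) r→p)
      in sat (c s) (c r) (neighbour∈b p~s) (neighbour∈b p~r) (s≢r ∘ inj)
             (trans (neighbour-colour p~s) (sym (neighbour-colour p~r)))
      where
      φcp≢φcq : φ (c p) ≢ φ (c q)
      φcp≢φcq = proper _ _ (⊕-separated-adjacent σ≼T (a , b , a≢b , cp∈a , cq∈b))
      neighbour-colour : ∀ {r} → Edge G (c p) (c r) → φ (c r) ≡ φ (c q)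
      neighbour-colour p~r = two-colours {φ = φ} {c = c} ¬three φcp≢φcq (proper _ _ p~r)
      neighbour∈b : ∀ {r} → Edge G (c p) (c r) → c r ∈ leaves (f b)
      neighbour∈b p~r = same-colour-same-child σ≼T (covers _) cq∈b (neighbour-colour p~r)

    AtMostOneUnsaturated⇒Acyclic : AtMostOneUnsaturatedIn T φ → Acyclic G φ
    AtMostOneUnsaturated⇒Acyclic amou =
      proper , λ k c cycle → decidable-stable (UsesThreeColors? φ c) (uses-three-colours cycle)
      where
      uses-three-colours : ∀ {k c} → IsCycle G k c → ¬ ¬ UsesThreeColors φ c
      uses-three-colours cycle@(_ , _ , edge) ¬three with cycle-crossing {K = G} cycle
      ... | crossing ∪ σ≼T _ next sep = ∪-separated-nonadjacent σ≼T sep (edge _ _ next)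
      ... | crossing ⊕ σ≼T covers _ (a , b , a≢b , cᵢ∈a , cⱼ∈b) =
        a≢b (amou _ _ σ≼T a b
               (two-coloured-cycle-unsaturates cycle ¬three σ≼T covers (a≢b ∘ sym) cⱼ∈b cᵢ∈a)
               (two-coloured-cycle-unsaturates cycle ¬three σ≼T covers a≢b cᵢ∈a cⱼ∈b))

    saturatedFill-proper : Proper (saturatedFill φ) φ
    saturatedFill-proper x y x~y with saturatedFill-edge⁻ φ x~y
    ... | inj₁ x~ᴳy                          = proper x y x~ᴳy
    ... | inj₂ (x≢y , _ , _ , sat , x∈ , y∈) = sat x y x∈ y∈ x≢y

lemma3 : ∀ {n : ℕ} (G : Graph n) (φ : Coloring n) → Cograph G → Proper G φ →
           (Acyclic G φ ⇔ AtMostOneUnsaturated G φ)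
           × (AtMostOneUnsaturated G φ ⇔ (∃[ H ] (Triangulation G H × Proper H φ)))
lemma3 G φ (T , cot) proper =
  mk⇔ (λ acyclic T′ cot′ → Acyclic⇒AtMostOneUnsaturated G cot′ acyclic)
      (λ amou → AtMostOneUnsaturated⇒Acyclic G cot proper (amou T cot)) ,
  mk⇔ (λ amou → saturatedFill G cot φ ,
                (saturatedFill-chordal G cot φ (amou T cot) , saturatedFill-supergraph G cot φ) ,
                saturatedFill-proper G cot proper)
      (λ triangulation T′ cot′ → ProperTriangulation⇒AtMostOneUnsaturated G cot′ triangulation)
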